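{- Let $a$ be an $r$-graphical sequence of length $n$ and let $b$ be a nonnegative integral sequence of length $n$ with $a$ majorizing $b$. Suppose $a=a_0,a_1,\dots,a_l=b$ are nonnegative integral sequences such that, for $0\le i\le l-1$, $a_{i+1}$ is obtained from $a_i$ by a unit transformation. Then each $a_i$, in particular $b$, is $r$-graphical.
   Context: An $r$-graph on $[n]$ is a pair $([n],E)$ where $E$ is a set of $r$-element subsets of $[n]$; its degree sequence lists, for each vertex $j$, the number of edges containing $j$. A sequence is $r$-graphical if it is the degree sequence of some $r$-graph on $[n]$. For a sequence $a=(a(1),\dots,a(n))$ with $a(i)\ge a(j)+2$, the unit transformation from $i$ to $j$ subtracts 1 from $a(i)$ and adds 1 to $a(j)$. With $a[i]$ the $i$-th largest component, $a$ majorizes $b$ if $\sum_{i\le k}a[i]\ge\sum_{i\le k}b[i]$ for all $k$, with equality at $k=n$. -}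

module Defs where

open import Data.Nat using (ℕ; suc; _+_; _≤_; _≥_)
open import Data.Nat.Properties using (≤-decTotalOrder)
open import Data.Fin using (Fin; zero; fromℕ)
open import Data.Fin.Subset using (Subset; ∣_∣)
open import Data.Fin.Subset.Properties using (_∈?_)
open import Data.List using (List; length; filter; take)
open import Data.Nat.ListAction using (sum)
open import Data.List.Relation.Unary.All using (All)
open import Data.List.Relation.Unary.Unique.Propositional using (Unique)
open import Data.Vec.Functional using (Vector; toList)
open import Data.Product using (Σ; ∃; _×_)
open import Relation.Binary.PropositionalEquality using (_≡_; _≢_)
import Relation.Binary.Construct.Flip.EqAndOrd as Flip
import Data.List.Sort as Sort

Seq : ℕ → Set
Seq n = Vector ℕ n

record RGraph (r n : ℕ) : Set where
  field
    edges    : List (Subset n)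
    distinct : Unique edges
    uniform  : All (λ e → ∣ e ∣ ≡ r) edges

degree : ∀ {r n} → RGraph r n → Fin n → ℕ
degree G j = length (filter (j ∈?_) (RGraph.edges G))

degSeq : ∀ {r n} → RGraph r n → Seq n
degSeq G j = degree G j

Graphical : (r n : ℕ) → Seq n → Set
Graphical r n a = Σ (RGraph r n) λ G → ∀ j → degSeq G j ≡ a j

sortDesc : ∀ {n} → Seq n → List ℕ
sortDesc a = Sort.sort (Flip.decTotalOrder ≤-decTotalOrder) (toList a)

Majorizes : ∀ {n} → Seq n → Seq n → Set
Majorizes {n} a b =
  (∀ k → k ≤ n → sum (take k (sortDesc a)) ≥ sum (take k (sortDesc b)))
  × sum (sortDesc a) ≡ sum (sortDesc b)

UnitTransformation : ∀ {n} → Seq n → Seq n → Set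
UnitTransformation {n} a b =
  Σ (Fin n) λ i → Σ (Fin n) λ j →
    (a i ≥ a j + 2) × (suc (b i) ≡ a i) × (b j ≡ suc (a j))
    × (∀ k → k ≢ i → k ≢ j → b k ≡ a k)

-- If deg i > deg j in an r-graph, then more edges contain i but not j than
-- contain j but not i. The map e ↦ e − i + j (move i j e) is injective on the
-- former edges and sends them to edges of the latter kind, so it must hit a
-- non-edge for some e. Replacing that e by e − i + j keeps the graph r-uniform
-- and realizes the unit transformation from i to j; induction along the chain
-- finishes the proof.
module Submission where

open import Defs
import Data.Nat as ℕ
open ℕ using (ℕ; suc; _+_; _≤_; _<_; z≤n; s≤s)
open import Data.Nat.Properties
  using (+-suc; suc-injective; +-cancelʳ-≤; +-monoʳ-≤; <⇒≱; <-irrefl; <-≤-trans; m<m+n;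
         module ≤-Reasoning)
open import Data.Bool using () renaming (_≟_ to _≟ᵇ_)
open import Data.Fin using (Fin; zero; suc; fromℕ; inject₁; _≟_)
open import Data.Fin.Subset using (Subset; _∈_; _∉_; inside; outside; ∣_∣)
open import Data.Fin.Subset.Properties using (_∈?_)
open import Data.Vec using (Vec; _∷_; lookup; _[_]≔_; _[_]=_; here; there)
open import Data.Vec.Properties
  using ([]=-injective; []=⇒lookup; lookup⇒[]=; []≔-updates; []≔-minimal; []≔-idempotent;
         []≔-commutes; updateAt-id-local; lookup∘update′; ≡-dec)
open import Data.List using (List; []; _∷_; _++_; length; map; filter)
open import Data.List.Properties using (length-map; filter-accept; filter-reject)
open import Data.List.Relation.Unary.All as All using (All; []; _∷_)
open import Data.List.Relation.Unary.All.Properties using () renaming (map⁺ to All-map⁺)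
import Data.List.Relation.Unary.AllPairs as AllPairs
open import Data.List.Relation.Unary.Any using (Any; here; there; any?)
open import Data.List.Relation.Unary.Unique.Propositional using (Unique; []; _∷_)
open import Data.List.Relation.Unary.Unique.Propositional.Properties using (filter⁺)
open import Data.List.Relation.Binary.Subset.Propositional using (_⊆_)
open import Data.List.Membership.Propositional using (find; lose)
  renaming (_∈_ to _∈ˡ_; _∉_ to _∉ˡ_)
open import Data.List.Membership.Propositional.Properties
  using (∈-map⁻; ∈-filter⁻; ∈-filter⁺; ∈-∃++)
import Data.List.Membership.DecPropositional as DecMembership
open import Data.List.Relation.Binary.Permutation.Propositional
  using (_↭_; ↭-reflexive; ↭-trans; ↭-sym; ↭⇒↭ₛ)
open import Data.List.Relation.Binary.Permutation.Propositional.Properties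
  using (↭-length; filter-↭; All-resp-↭; ∈-resp-↭) renaming (shift to ↭-shift)
import Data.List.Relation.Binary.Permutation.Setoid.Properties as ↭ₛ
open import Data.Product using (Σ; _×_; _,_; proj₂)
open import Function using (_∘_; case_of_)
open import Relation.Nullary using (Dec; yes; no; ¬?; contradiction)
open import Relation.Nullary.Decidable using (_×-dec_; decidable-stable)
open import Relation.Binary.PropositionalEquality
  using (_≡_; _≢_; ≢-sym; refl; sym; trans; cong; subst; subst₂; setoid; module ≡-Reasoning)

private
  variable
    A B : Set
    xs ys : List A
    r n : ℕ
    i j k : Fin n
    e e′ : Subset n
    L : List (Subset n)

Unique-map⁺-on : {P : A → Set} {f : A → B} → (∀ {x y} → P x → P y → f x ≡ f y → x ≡ y) →
                 All P xs → Unique xs → Unique (map f xs)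
Unique-map⁺-on f-inj [] [] = []
Unique-map⁺-on f-inj (px ∷ pxs) (x∉xs ∷ !xs) =
  All-map⁺ (All.zipWith (λ (x≢y , py) fx≡fy → x≢y (f-inj px py fx≡fy)) (x∉xs , pxs))
  ∷ Unique-map⁺-on f-inj pxs !xs

Unique⇒length-≤ : Unique xs → xs ⊆ ys → length xs ≤ length ys
Unique⇒length-≤ {xs = []} _ _ = z≤n
Unique⇒length-≤ {xs = x ∷ xs} (x∉xs ∷ !xs) xs⊆ys
  with us , vs , refl ← ∈-∃++ (xs⊆ys (here refl)) =
  subst (suc (length xs) ≤_) (sym (↭-length (↭-shift x us vs)))
        (s≤s (Unique⇒length-≤ !xs xs⊆us++vs))
  where
  xs⊆us++vs : xs ⊆ us ++ vs
  xs⊆us++vs y∈xs with ∈-resp-↭ (↭-shift x us vs) (xs⊆ys (there y∈xs))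
  ... | here refl = contradiction refl (All.lookup x∉xs y∈xs)
  ... | there y∈us++vs = y∈us++vs

[]=⇒[]≔-id : ∀ {x : A} {v : Vec A n} → v [ k ]= x → v [ k ]≔ x ≡ v
[]=⇒[]≔-id {k = k} {v = v} v[k]=x = updateAt-id-local k v (sym ([]=⇒lookup v[k]=x))

∉⇒[]=outside : k ∉ e → e [ k ]= outside
∉⇒[]=outside {k = k} {e = e} k∉e with lookup e k in eq
... | inside = contradiction (lookup⇒[]= k e eq) k∉e
... | outside = lookup⇒[]= k e eq

∈-[]≔⁻ : ∀ {b} → i ≢ j → i ∈ e [ j ]≔ b → i ∈ e
∈-[]≔⁻ {i = i} {e = e} {b = b} i≢j i∈e[j]≔b =
  lookup⇒[]= i e (trans (sym (lookup∘update′ i≢j e b)) ([]=⇒lookup i∈e[j]≔b))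

∉-[]≔outside : i ∉ e [ i ]≔ outside
∉-[]≔outside {i = i} {e = e} i∈e[i]≔outside =
  contradiction ([]=-injective ([]≔-updates e i) i∈e[i]≔outside) λ ()

∣[]≔outside∣ : i ∈ e → suc ∣ e [ i ]≔ outside ∣ ≡ ∣ e ∣
∣[]≔outside∣ here = refl
∣[]≔outside∣ {e = inside ∷ e} (there i∈e) = cong suc (∣[]≔outside∣ i∈e)
∣[]≔outside∣ {e = outside ∷ e} (there i∈e) = ∣[]≔outside∣ i∈e

∣[]≔inside∣ : i ∉ e → ∣ e [ i ]≔ inside ∣ ≡ suc ∣ e ∣
∣[]≔inside∣ {i = zero} {e = outside ∷ e} _ = refl
∣[]≔inside∣ {i = zero} {e = inside ∷ e} i∉e = contradiction here i∉e
∣[]≔inside∣ {i = suc i} {e = outside ∷ e} i∉e = ∣[]≔inside∣ (i∉e ∘ there)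
∣[]≔inside∣ {i = suc i} {e = inside ∷ e} i∉e = cong suc (∣[]≔inside∣ (i∉e ∘ there))

Separates : Fin n → Fin n → Subset n → Set
Separates i j e = i ∈ e × j ∉ e

separates? : (i j : Fin n) (e : Subset n) → Dec (Separates i j e)
separates? i j e = i ∈? e ×-dec ¬? (j ∈? e)

move : Fin n → Fin n → Subset n → Subset n
move i j e = e [ i ]≔ outside [ j ]≔ inside

j∈move : j ∈ move i j e
j∈move {j = j} {i = i} {e = e} = []≔-updates (e [ i ]≔ outside) j

i∉move : i ≢ j → i ∉ move i j e
i∉move i≢j i∈move = ∉-[]≔outside (∈-[]≔⁻ i≢j i∈move)

move-separates : i ≢ j → Separates j i (move i j e)
move-separates i≢j = j∈move , i∉move i≢j

∈-move⁺ : k ≢ i → k ≢ j → k ∈ e → k ∈ move i j e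
∈-move⁺ {k = k} {i = i} {j = j} {e = e} k≢i k≢j k∈e =
  []≔-minimal (e [ i ]≔ outside) k j k≢j ([]≔-minimal e k i k≢i k∈e)

∈-move⁻ : k ≢ i → k ≢ j → k ∈ move i j e → k ∈ e
∈-move⁻ k≢i k≢j k∈move = ∈-[]≔⁻ k≢i (∈-[]≔⁻ k≢j k∈move)

∣move∣ : i ≢ j → Separates i j e → ∣ move i j e ∣ ≡ ∣ e ∣
∣move∣ i≢j (i∈e , j∉e) =
  trans (∣[]≔inside∣ (j∉e ∘ ∈-[]≔⁻ (≢-sym i≢j))) (∣[]≔outside∣ i∈e)

move-move : i ≢ j → Separates i j e → move j i (move i j e) ≡ e
move-move {i = i} {j = j} {e = e} i≢j (i∈e , j∉e) = begin
  e [ i ]≔ outside [ j ]≔ inside [ j ]≔ outside [ i ]≔ inside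
    ≡⟨ cong (_[ i ]≔ inside) ([]≔-idempotent (e [ i ]≔ outside) j) ⟩
  e [ i ]≔ outside [ j ]≔ outside [ i ]≔ inside
    ≡⟨ cong (_[ i ]≔ inside) ([]≔-commutes e i j i≢j) ⟩
  e [ j ]≔ outside [ i ]≔ outside [ i ]≔ inside
    ≡⟨ []≔-idempotent (e [ j ]≔ outside) i ⟩
  e [ j ]≔ outside [ i ]≔ inside
    ≡⟨ cong (_[ i ]≔ inside) ([]=⇒[]≔-id (∉⇒[]=outside j∉e)) ⟩
  e [ i ]≔ inside
    ≡⟨ []=⇒[]≔-id i∈e ⟩
  e ∎
  where open ≡-Reasoning

move-injective : i ≢ j → Separates i j e → Separates i j e′ → move i j e ≡ move i j e′ → e ≡ e′
move-injective {i = i} {j = j} i≢j sep sep′ eq =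
  trans (sym (move-move i≢j sep)) (trans (cong (move j i) eq) (move-move i≢j sep′))

degreeIn : Fin n → List (Subset n) → ℕ
degreeIn k L = length (filter (k ∈?_) L)

degreeIn-∷-∈ : ∀ L → k ∈ e → degreeIn k (e ∷ L) ≡ suc (degreeIn k L)
degreeIn-∷-∈ {k = k} _ k∈e = cong length (filter-accept (k ∈?_) k∈e)

degreeIn-∷-∉ : ∀ L → k ∉ e → degreeIn k (e ∷ L) ≡ degreeIn k L
degreeIn-∷-∉ {k = k} _ k∉e = cong length (filter-reject (k ∈?_) k∉e)

degreeIn-resp-↭ : ∀ {L L′ : List (Subset n)} → L ↭ L′ → degreeIn k L ≡ degreeIn k L′
degreeIn-resp-↭ {k = k} L↭L′ = ↭-length (filter-↭ (k ∈?_) L↭L′)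

degreeIn-move-source : i ≢ j → i ∈ e → suc (degreeIn i (move i j e ∷ L)) ≡ degreeIn i (e ∷ L)
degreeIn-move-source {i = i} {L = L} i≢j i∈e =
  trans (cong suc (degreeIn-∷-∉ L (i∉move i≢j))) (sym (degreeIn-∷-∈ L i∈e))

degreeIn-move-target : j ∉ e → degreeIn j (move i j e ∷ L) ≡ suc (degreeIn j (e ∷ L))
degreeIn-move-target {L = L} j∉e =
  trans (degreeIn-∷-∈ L j∈move) (cong suc (sym (degreeIn-∷-∉ L j∉e)))

degreeIn-move-other : k ≢ i → k ≢ j → degreeIn k (move i j e ∷ L) ≡ degreeIn k (e ∷ L)
degreeIn-move-other {k = k} {e = e} {L = L} k≢i k≢j = case k ∈? e of λ where
  (yes k∈e) → trans (degreeIn-∷-∈ L (∈-move⁺ k≢i k≢j k∈e)) (sym (degreeIn-∷-∈ L k∈e))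
  (no k∉e) → trans (degreeIn-∷-∉ L (k∉e ∘ ∈-move⁻ k≢i k≢j)) (sym (degreeIn-∷-∉ L k∉e))

separating : Fin n → Fin n → List (Subset n) → List (Subset n)
separating i j = filter (separates? i j)

degreeIn-balance : ∀ (i j : Fin n) L →
  degreeIn i L + length (separating j i L) ≡ degreeIn j L + length (separating i j L)
degreeIn-balance i j [] = refl
degreeIn-balance i j (e ∷ L) with i ∈? e | j ∈? e
... | yes _ | yes _ = cong suc (degreeIn-balance i j L)
... | yes _ | no _ = trans (cong suc (degreeIn-balance i j L)) (sym (+-suc _ _))
... | no _ | yes _ = trans (+-suc _ _) (cong suc (degreeIn-balance i j L))
... | no _ | no _ = degreeIn-balance i j L

length-separating-≤ : i ≢ j → Unique L →
  (∀ {e} → e ∈ˡ L → Separates i j e → move i j e ∈ˡ L) →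
  length (separating i j L) ≤ length (separating j i L)
length-separating-≤ {i = i} {j = j} {L = L} i≢j !L closed =
  subst (_≤ length (separating j i L)) (length-map (move i j) (separating i j L))
        (Unique⇒length-≤ !moved moved⊆separating)
  where
  !moved : Unique (map (move i j) (separating i j L))
  !moved = Unique-map⁺-on (move-injective i≢j)
             (All.tabulate (λ e∈ → proj₂ (∈-filter⁻ (separates? i j) {xs = L} e∈)))
             (filter⁺ (separates? i j) !L)
  moved⊆separating : map (move i j) (separating i j L) ⊆ separating j i L
  moved⊆separating e′∈ with e , e∈ , refl ← ∈-map⁻ (move i j) e′∈
    with e∈L , sep ← ∈-filter⁻ (separates? i j) e∈ =
    ∈-filter⁺ (separates? j i) (closed e∈L sep) (move-separates i≢j)

_∈ˡ?_ : (e : Subset n) (L : List (Subset n)) → Dec (e ∈ˡ L)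
_∈ˡ?_ = DecMembership._∈?_ (≡-dec _≟ᵇ_)

∃-separating-move-fresh : i ≢ j → Unique L → degreeIn j L < degreeIn i L →
  Any (λ e → Separates i j e × move i j e ∉ˡ L) L
∃-separating-move-fresh {i = i} {j = j} {L = L} i≢j !L degj<degi
  with any? (λ e → separates? i j e ×-dec ¬? (move i j e ∈ˡ? L)) L
... | yes fresh = fresh
... | no ¬fresh = contradiction degi≤degj (<⇒≱ degj<degi)
  where
  closed : ∀ {e} → e ∈ˡ L → Separates i j e → move i j e ∈ˡ L
  closed {e} e∈L sep =
    decidable-stable (move i j e ∈ˡ? L) (λ move∉L → ¬fresh (lose e∈L (sep , move∉L)))
  degi≤degj : degreeIn i L ≤ degreeIn j L
  degi≤degj = +-cancelʳ-≤ (length (separating j i L)) (degreeIn i L) (degreeIn j L) (begin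
    degreeIn i L + length (separating j i L) ≡⟨ degreeIn-balance i j L ⟩
    degreeIn j L + length (separating i j L)
      ≤⟨ +-monoʳ-≤ (degreeIn j L) (length-separating-≤ i≢j !L closed) ⟩
    degreeIn j L + length (separating j i L) ∎)
    where open ≤-Reasoning

exchangeEdge : (G : RGraph r n) → e ∈ˡ RGraph.edges G → e′ ∉ˡ RGraph.edges G → ∣ e′ ∣ ≡ r →
  Σ (List (Subset n)) λ L → RGraph.edges G ↭ e ∷ L × Σ (RGraph r n) λ G′ → RGraph.edges G′ ≡ e′ ∷ L
exchangeEdge {n = n} {e = e} {e′ = e′} G e∈G e′∉G ∣e′∣≡r
  with us , vs , edges≡ ← ∈-∃++ e∈G =
  us ++ vs , σ , G′ , refl
  where
  open RGraph G
  σ : edges ↭ e ∷ us ++ vs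
  σ = ↭-trans (↭-reflexive edges≡) (↭-shift e us vs)
  G′ : RGraph _ n
  G′ = record
    { edges = e′ ∷ us ++ vs
    ; distinct = All.tabulate (λ { e″∈ refl → e′∉G (∈-resp-↭ (↭-sym σ) (there e″∈)) })
                 ∷ AllPairs.tail (↭ₛ.Unique-resp-↭ (setoid (Subset n)) (↭⇒↭ₛ σ) distinct)
    ; uniform = ∣e′∣≡r ∷ All.tail (All-resp-↭ σ uniform)
    }

UnitShift : Fin n → Fin n → Seq n → Seq n → Set
UnitShift i j a b = suc (b i) ≡ a i × b j ≡ suc (a j) × (∀ k → k ≢ i → k ≢ j → b k ≡ a k)

UnitShift-unique : ∀ {a a′ b b′ : Seq n} → (∀ k → a k ≡ a′ k) →
  UnitShift i j a b → UnitShift i j a′ b′ → ∀ k → b k ≡ b′ k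
UnitShift-unique {i = i} {j = j} a≗a′ (bi , bj , bk) (b′i , b′j , b′k) k with k ≟ i | k ≟ j
... | yes refl | _ = suc-injective (trans bi (trans (a≗a′ i) (sym b′i)))
... | no _ | yes refl = trans bj (trans (cong suc (a≗a′ j)) (sym b′j))
... | no k≢i | no k≢j = trans (bk k k≢i k≢j) (trans (a≗a′ k) (sym (b′k k k≢i k≢j)))

transferDegree : (G : RGraph r n) → degree G j < degree G i →
  Σ (RGraph r n) λ G′ → UnitShift i j (degSeq G) (degSeq G′)
transferDegree {n = n} {j = j} {i = i} G degj<degi =
  replace (find (∃-separating-move-fresh i≢j distinct degj<degi))
  where
  open RGraph G
  i≢j : i ≢ j
  i≢j refl = <-irrefl refl degj<degi
  replace : Σ (Subset n) (λ e → e ∈ˡ edges × Separates i j e × move i j e ∉ˡ edges) →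
            Σ (RGraph _ n) λ G′ → UnitShift i j (degSeq G) (degSeq G′)
  replace (e , e∈G , sep@(i∈e , j∉e) , move∉G)
    with L , σ , G′ , edges′≡ ← exchangeEdge G e∈G move∉G
                                  (trans (∣move∣ i≢j sep) (All.lookup uniform e∈G))
    = G′
    , trans (cong suc (new i)) (trans (degreeIn-move-source i≢j i∈e) (old i))
    , trans (new j) (trans (degreeIn-move-target j∉e) (cong suc (old j)))
    , λ k k≢i k≢j → trans (new k) (trans (degreeIn-move-other k≢i k≢j) (old k))
    where
    old : ∀ k → degreeIn k (e ∷ L) ≡ degree G k
    old k = sym (degreeIn-resp-↭ σ)
    new : ∀ k → degree G′ k ≡ degreeIn k (move i j e ∷ L)
    new k = cong (degreeIn k) edges′≡

UnitTransformation-preserves-Graphical : ∀ {r n} {a b : Seq n} →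
  Graphical r n a → UnitTransformation a b → Graphical r n b
UnitTransformation-preserves-Graphical {a = a} (G , degG≗a) (i , j , aj+2≤ai , a⇝b) =
  let aj<ai = <-≤-trans (m<m+n (a j) (s≤s z≤n)) aj+2≤ai
      degj<degi = subst₂ _<_ (sym (degG≗a j)) (sym (degG≗a i)) aj<ai
      G′ , degG⇝degG′ = transferDegree G degj<degi
  in G′ , UnitShift-unique degG≗a degG⇝degG′ a⇝b

Graphical-along-UnitTransformations : ∀ {r n} l (s : Fin (suc l) → Seq n) →
  Graphical r n (s zero) → (∀ (i : Fin l) → UnitTransformation (s (inject₁ i)) (s (suc i))) →
  ∀ i → Graphical r n (s i)
Graphical-along-UnitTransformations l s s₀-graphical steps zero = s₀-graphical
Graphical-along-UnitTransformations (suc l) s s₀-graphical steps (suc i) =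
  Graphical-along-UnitTransformations l (s ∘ suc)
    (UnitTransformation-preserves-Graphical s₀-graphical (steps zero)) (steps ∘ suc) i

lemma6p2 : (r n : ℕ) (a b : Seq n) → Graphical r n a → Majorizes a b
           → (l : ℕ) (s : Fin (ℕ.suc l) → Seq n)
           → s zero ≡ a → s (fromℕ l) ≡ b
           → (∀ (i : Fin l) → UnitTransformation (s (inject₁ i)) (s (suc i)))
           → ∀ (i : Fin (ℕ.suc l)) → Graphical r n (s i)
lemma6p2 r n a b a-graphical _ l s s₀≡a _ steps =
  Graphical-along-UnitTransformations l s (subst (Graphical r n) (sym s₀≡a) a-graphical) steps
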